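{- Let $\pi:\mathbb{N}\to\mathbb{N}$ be an injective function whose values are all prime numbers, writing $\pi_u$ for $\pi(u)$. For every predicate $p:\mathbb{N}\to\mathbb{P}$ and every bound $n:\mathbb{N}$, $$\neg\neg\,\exists c:\mathbb{N}\ \forall u:\mathbb{N}.\ \big(u<n\to(p\,u\leftrightarrow\pi_u\mid c)\big)\land\big(\pi_u\mid c\to u<n\big).$$ Moreover, if $p$ is definite (i.e. $\forall x.\ p\,x\lor\neg p\,x$), the same holds without the double negation.
   Context: Meta-theory: constructive type theory (Calculus of Inductive Constructions); $\mathbb{P}$ is the universe of propositions; no classical axioms are assumed. $\mid$ is divisibility on $\mathbb{N}$. -}

module Submission where

open import Data.Nat using (ℕ; _<_; zero; suc; _*_)
open import Data.Nat.Divisibility using (_∣_; ∣1⇒≡1; m∣m*n; ∣n⇒∣m*n)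
open import Data.Nat.Primality using (Prime; euclidsLemma; prime⇒irreducible; ¬prime[1])
open import Data.Nat.Properties using (m<n⇒m<1+n; n<1+n; m<1+n⇒m<n∨m≡n)
open import Data.Product using (_×_; ∃; _,_; proj₁; proj₂; map₁)
open import Data.Sum using (_⊎_; inj₁; inj₂)
open import Effect.Monad using (RawMonad)
open import Function.Base using (_∘_)
open import Function.Bundles using (_⇔_; mk⇔)
open import Function.Definitions using (Injective)
open import Relation.Binary.PropositionalEquality using (_≡_; refl; subst)
open import Relation.Nullary using (¬_; Dec; yes; no; contradiction)
open import Relation.Nullary.Decidable using (fromSum; ¬¬-excluded-middle)
open import Relation.Nullary.Negation using (¬¬-Monad)

-- The code of p below n is the product of the primes π x over the x < n with p x.
-- By Euclid's lemma a prime π u divides it only if it equals one of these factors,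
-- and π u = π x forces u = x by injectivity.  The code can be formed as soon as p
-- is decidable below n, which holds outright for definite p and is not refutable
-- for any p, since excluded middle for finitely many propositions is not refutable.

prime∤1 : ∀ {q} → Prime q → ¬ q ∣ 1
prime∤1 q-prime q∣1 = ¬prime[1] (subst Prime (∣1⇒≡1 q∣1) q-prime)

prime∣prime⇒≡ : ∀ {q r} → Prime q → Prime r → q ∣ r → q ≡ r
prime∣prime⇒≡ q-prime r-prime q∣r with prime⇒irreducible r-prime q∣r
... | inj₁ refl = contradiction q-prime ¬prime[1]
... | inj₂ q≡r = q≡r

DecidableBelow : (ℕ → Set) → ℕ → Set
DecidableBelow p n = ∀ x → x < n → Dec (p x)

module _ {p : ℕ → Set} where

  restrict : ∀ {n} → DecidableBelow p (suc n) → DecidableBelow p n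
  restrict d x x<n = d x (m<n⇒m<1+n x<n)

  extend : ∀ {n} → DecidableBelow p n → Dec (p n) → DecidableBelow p (suc n)
  extend {n} d p? x x<1+n with m<1+n⇒m<n∨m≡n x<1+n
  ... | inj₁ x<n = d x x<n
  ... | inj₂ refl = p?

  ¬¬-decidableBelow : ∀ n → ¬ ¬ DecidableBelow p n
  ¬¬-decidableBelow zero = contradiction (λ _ ())
  ¬¬-decidableBelow (suc n) = do
      d ← ¬¬-decidableBelow n
      p? ← ¬¬-excluded-middle
      return (extend d p?)
    where open RawMonad ¬¬-Monad

module Coding (π : ℕ → ℕ) (π-injective : Injective _≡_ _≡_ π)
              (π-prime : ∀ u → Prime (π u)) {p : ℕ → Set} where

  Codes : ℕ → ℕ → Set
  Codes n c = ∀ u → (u < n → (p u ⇔ (π u ∣ c))) × (π u ∣ c → u < n)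

  π∣π⇒≡ : ∀ {u v} → π u ∣ π v → u ≡ v
  π∣π⇒≡ πu∣πv = π-injective (prime∣prime⇒≡ (π-prime _) (π-prime _) πu∣πv)

  code : ∀ n → DecidableBelow p n → ℕ
  code zero    d = 1
  code (suc n) d with d n (n<1+n n)
  ... | yes _ = π n * code n (restrict d)
  ... | no  _ = code n (restrict d)

  p⇒π∣code : ∀ n (d : DecidableBelow p n) {u} → u < n → p u → π u ∣ code n d
  p⇒π∣code (suc n) d u<1+n pu with d n (n<1+n n) | m<1+n⇒m<n∨m≡n u<1+n
  ... | yes _   | inj₁ u<n = ∣n⇒∣m*n (π n) (p⇒π∣code n (restrict d) u<n pu)
  ... | yes _   | inj₂ refl = m∣m*n (code n (restrict d))
  ... | no  _   | inj₁ u<n = p⇒π∣code n (restrict d) u<n pu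
  ... | no  ¬pn | inj₂ refl = contradiction pu ¬pn

  π∣code⇒<×p : ∀ n (d : DecidableBelow p n) {u} → π u ∣ code n d → u < n × p u
  π∣code⇒<×p zero d {u} πu∣1 = contradiction πu∣1 (prime∤1 (π-prime u))
  π∣code⇒<×p (suc n) d {u} πu∣c with d n (n<1+n n)
  ... | no _ = map₁ m<n⇒m<1+n (π∣code⇒<×p n (restrict d) πu∣c)
  ... | yes pn with euclidsLemma (π n) (code n (restrict d)) (π-prime u) πu∣c
  ...   | inj₁ πu∣πn rewrite π∣π⇒≡ πu∣πn = n<1+n n , pn
  ...   | inj₂ πu∣c′ = map₁ m<n⇒m<1+n (π∣code⇒<×p n (restrict d) πu∣c′)

  code-codes : ∀ n (d : DecidableBelow p n) → Codes n (code n d)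
  code-codes n d u =
      (λ u<n → mk⇔ (p⇒π∣code n d u<n) (proj₂ ∘ π∣code⇒<×p n d))
    , proj₁ ∘ π∣code⇒<×p n d

corollary5p2 : (π : ℕ → ℕ) → Injective _≡_ _≡_ π → (∀ u → Prime (π u))
    → ((p : ℕ → Set) (n : ℕ)
    → ¬ ¬ (∃ λ c → ∀ u → ((u < n → (p u ⇔ (π u ∣ c))) × (π u ∣ c → u < n))))
    × ((p : ℕ → Set) (n : ℕ) → (∀ x → p x ⊎ ¬ p x)
    → ∃ λ c → ∀ u → ((u < n → (p u ⇔ (π u ∣ c))) × (π u ∣ c → u < n)))
corollary5p2 π π-injective π-prime =
    (λ _ n ¬code → ¬¬-decidableBelow n (λ d → ¬code (codeOf n d)))
  , (λ _ n p-definite → codeOf n (λ x _ → fromSum (p-definite x)))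
  where
  open Coding π π-injective π-prime
  codeOf : ∀ {p} n (d : DecidableBelow p n) → ∃ (Codes n)
  codeOf n d = code n d , code-codes n d
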